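{- Let $k\ge1$, let $\nu,\mu$ be partitions, and fix $n\ge\ell(\nu)$ with $n>\ell(\mu)$. Then $\nu/\mu$ is a horizontal strip if and only if $\mathcal{P}_k(\nu,\mu)$ is a base graph. Moreover, $\mathcal{P}_k(\nu,\mu)$ is a base graph that is a tree if and only if $\nu/\mu$ is a horizontal strip with $\nu_i-\mu_i<k$ for every $i$.
   Context: $\nu/\mu$ is a horizontal strip if $\mu_i\le\nu_i$ for all $i$ and no two cells of $\nu/\mu$ (cells $(i,j)$ with $\mu_i<j\le\nu_i$) lie in the same column. Set $\mu_0=+\infty$; for $0\le m\le n-1$ let $I_m=\{t\in\mathbb Z:m-\mu_m\le t<m+1-\mu_{m+1}\}$ and $I_n=\{t\ge n\}$. For $i=1,\dots,n$ let $a_i,b_i$ be such that $i-\nu_i-1\in I_{a_i}$ and $i-\nu_i-1+k\in I_{b_i}$; then row $i$ of the $n\times n$ matrix $\operatorname{Pet}_k(\nu,\mu)=([0\le\nu_i-i-\mu_j+j<k])_{i,j}$ has ones exactly in positions $a_i+1,\dots,b_i$. $\mathcal{P}_k(\nu,\mu)$ is the multigraph on $\{0,\dots,n\}$ with one edge $\{a_i,b_i\}$ for each row $i$ (loops allowed). It is a base graph if $(a_1,\dots,a_n)$ is a permutation of $\{0,\dots,n-1\}$, i.e. orienting every edge from $a_i$ to $b_i$ gives every vertex other than $n$ exactly one outgoing edge. -}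

module Defs where

open import Data.Nat as ℕ using (ℕ; zero; suc; _≤_; _<_; _≥_)
open import Data.Integer as ℤ using (ℤ; +_; _-_)
open import Data.Fin using (Fin; toℕ)
open import Data.List using (List; []; _∷_; _++_; tabulate; map; upTo; length)
open import Data.List.Relation.Unary.All using (All)
open import Data.List.Relation.Unary.Linked using (Linked)
open import Data.List.Relation.Unary.Unique.Propositional using (Unique)
open import Data.List.Relation.Binary.Permutation.Propositional using (_↭_)
open import Data.Product using (Σ; _×_; ∃; proj₁; proj₂)
open import Data.Sum using (_⊎_)
open import Data.Unit using (⊤)
open import Relation.Nullary using (¬_)
open import Relation.Binary.PropositionalEquality using (_≡_)

IsPartition : List ℕ → Set
IsPartition xs = All (λ x → 0 < x) xs × Linked _≥_ xs

-- ℓ(λ) = length of the list.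
-- 1-indexed parts: part λ i = λ_i for i ≥ 1 (0 beyond the length);
-- the value at index 0 is never used (μ_0 = +∞ is handled separately).
part : List ℕ → ℕ → ℕ
part []       _             = 0
part (x ∷ xs) zero          = 0
part (x ∷ xs) (suc zero)    = x
part (x ∷ xs) (suc (suc i)) = part xs (suc i)

InSkew : List ℕ → List ℕ → ℕ → ℕ → Set
InSkew ν μ i j = 1 ≤ i × part μ i < j × j ≤ part ν i

HorizontalStrip : List ℕ → List ℕ → Set
HorizontalStrip ν μ =
  (∀ i → 1 ≤ i → part μ i ≤ part ν i) ×
  (∀ i i' j → InSkew ν μ i j → InSkew ν μ i' j → i ≡ i')

-- The intervals I_m (depending on μ and n), μ_0 = +∞.
-- For 0 ≤ m ≤ n-1 : I_m = { t : m - μ_m ≤ t < m + 1 - μ_{m+1} }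
-- (the lower bound is vacuous for m = 0), and I_n = { t ≥ n }.

LowerI : List ℕ → ℕ → ℤ → Set
LowerI μ zero    t = ⊤
LowerI μ (suc m) t = (+ suc m - + part μ (suc m)) ℤ.≤ t

InI : List ℕ → ℕ → ℕ → ℤ → Set
InI μ n m t =
  (m < n × LowerI μ m t × t ℤ.< (+ suc m - + part μ (suc m)))
  ⊎ (m ≡ n × + n ℤ.≤ t)

-- For row i (Fin n, representing i = toℕ i + 1): i - ν_i - 1
rowT : List ℕ → {n : ℕ} → Fin n → ℤ
rowT ν i = (+ suc (toℕ i) - + part ν (suc (toℕ i))) - + 1

Multigraph : Set → Set → Set
Multigraph V E = E → V × V

Joins : {V E : Set} → Multigraph V E → E → V → V → Set
Joins g e u v =
  (proj₁ (g e) ≡ u × proj₂ (g e) ≡ v) ⊎ (proj₁ (g e) ≡ v × proj₂ (g e) ≡ u)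

data Walk {V E : Set} (g : Multigraph V E) : V → V → List E → Set where
  nil  : ∀ {u} → Walk g u u []
  cons : ∀ {u w v es} e → Joins g e u w → Walk g w v es → Walk g u v (e ∷ es)

Connected : {V E : Set} → Multigraph V E → Set
Connected {V} {E} g = ∀ (u v : V) → Σ (List E) λ es → Walk g u v es

data Trail {V E : Set} (g : Multigraph V E) : List V → List E → Set where
  single : ∀ v → Trail g (v ∷ []) []
  step   : ∀ {u w vs es} e → Joins g e u w → Trail g (w ∷ vs) es →
           Trail g (u ∷ w ∷ vs) (e ∷ es)

-- A cycle: closed trail v, v₁, …, v_{k-1}, v (k ≥ 1) with distinct
-- vertices v, v₁, …, v_{k-1} and distinct edges (loops are cycles of
-- length 1, a pair of parallel edges is a cycle of length 2).
HasCycle : {V E : Set} → Multigraph V E → Set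
HasCycle {V} {E} g =
  Σ V λ v → Σ (List V) λ vs → Σ (List E) λ es →
    Trail g (v ∷ vs ++ v ∷ []) es × Unique (v ∷ vs) × Unique es

IsTree : {V E : Set} → Multigraph V E → Set
IsTree g = Connected g × ¬ HasCycle g

Pgraph : (n : ℕ) → (Fin n → Fin (suc n)) → (Fin n → Fin (suc n)) →
         Multigraph (Fin (suc n)) (Fin n)
Pgraph n a b i = a i Data.Product., b i

IsBaseGraph : (n : ℕ) → (Fin n → Fin (suc n)) → Set
IsBaseGraph n a = map toℕ (tabulate a) ↭ upTo n

-- Row i of Pet_k has its first one in column a_i + 1, and the intervals I_m are ordered, so
-- a_i is weakly increasing in i.  Hence the a_i form a permutation of {0,…,n-1} exactly when
-- a_i = i - 1 for all i, i.e. when i - ν_i - 1 lies in I_{i-1}; unfolding the bounds of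
-- I_{i-1} this says ν_{i+1} ≤ μ_i ≤ ν_i, the interlacing characterisation of horizontal strips.
-- In that case edge i joins i - 1 to b_i ≥ i - 1, and b_i > i - 1 is exactly ν_i < μ_i + k.  If
-- every b_i > i - 1, each vertex below n has a unique edge leading upwards, which makes the
-- graph a tree rooted at n; if some b_i = i - 1, that edge is a loop.
module Submission where

open import Defs
open import Data.Nat using (ℕ; zero; suc; _≤_; _<_; _+_; _≥_; z≤n; s≤s; s≤s⁻¹; _≤′_; _<?_)
import Data.Nat.Properties as ℕₚ
open import Algebra.Properties.CommutativeSemigroup ℕₚ.+-commutativeSemigroup using (x∙yz≈xz∙y)
open import Data.Integer using (+_) renaming (_+_ to _+ℤ_)
import Data.Integer as ℤ
import Data.Integer.Properties as ℤₚ
open import Data.Integer.Tactic.RingSolver using (solve-∀)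
open import Data.Fin using (Fin; toℕ; fromℕ; fromℕ<)
import Data.Fin as Fin
open import Data.Fin.Properties using (toℕ-injective; toℕ<n; toℕ≤pred[n]; toℕ-fromℕ; toℕ-fromℕ<)
open import Data.List using (List; []; _∷_; _++_; length; tabulate; upTo; applyUpTo)
open import Data.List.Properties using (map-tabulate; tabulate-cong; ∷-injective)
open import Data.List.Relation.Unary.All using (All; []; _∷_)
open import Data.List.Relation.Unary.All.Properties using (All¬⇒¬Any)
open import Data.List.Relation.Unary.Any using (Any; here; there)
open import Data.List.Relation.Unary.AllPairs using ([]; _∷_)
open import Data.List.Relation.Unary.Linked using (Linked; []; [-]; _∷_)
open import Data.List.Relation.Unary.Unique.Propositional using (Unique)
open import Data.List.Relation.Unary.Sorted.TotalOrder.Properties using (↗↭↗⇒≋)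
open import Data.List.Relation.Binary.Permutation.Propositional using (_↭_; ↭-reflexive; ↭⇒↭ₛ)
open import Data.List.Relation.Binary.Pointwise using (Pointwise-≡⇒≡)
open import Data.Product using (∃; _×_; _,_; proj₁; proj₂)
open import Data.Sum using (_⊎_; inj₁; inj₂)
import Data.Sum as Sum
open import Data.Unit using (tt)
open import Data.Empty using (⊥-elim)
open import Function.Base using (_∘_)
open import Function.Bundles using (_⇔_; mk⇔; Equivalence)
open import Function.Construct.Composition using (_⇔-∘_)
open import Function.Construct.Symmetry using (⇔-sym)
open import Relation.Nullary using (¬_; yes; no)
open import Relation.Binary.PropositionalEquality

open Equivalence

module _ (a b c d : ℕ) where

  private
    offset : ℤ.ℤ
    offset = + b +ℤ + d

    add-offset : ∀ x y z → (x ℤ.- y) +ℤ (y +ℤ z) ≡ x +ℤ z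
    add-offset = solve-∀

    add-offset′ : ∀ x y z → (x ℤ.- y) +ℤ (z +ℤ y) ≡ x +ℤ z
    add-offset′ = solve-∀

    left : (+ a ℤ.- + b) +ℤ offset ≡ + (a + d)
    left = trans (add-offset (+ a) (+ b) (+ d)) (sym (ℤₚ.pos-+ a d))

    right : (+ c ℤ.- + d) +ℤ offset ≡ + (c + b)
    right = trans (add-offset′ (+ c) (+ d) (+ b)) (sym (ℤₚ.pos-+ c b))

    remove-offset : ∀ x → (x +ℤ offset) ℤ.- offset ≡ x
    remove-offset x = solve x offset
      where
      solve : ∀ x w → (x +ℤ w) ℤ.- w ≡ x
      solve = solve-∀

  diff-≤ : (+ a ℤ.- + b ℤ.≤ + c ℤ.- + d) ⇔ (a + d ≤ c + b)
  diff-≤ = mk⇔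
    (λ h → ℤₚ.drop‿+≤+ (subst₂ ℤ._≤_ left right (ℤₚ.+-monoˡ-≤ offset h)))
    (λ h → subst₂ ℤ._≤_ (remove-offset _) (remove-offset _)
             (ℤₚ.+-monoˡ-≤ (ℤ.- offset) (subst₂ ℤ._≤_ (sym left) (sym right) (ℤ.+≤+ h))))

  diff-< : (+ a ℤ.- + b ℤ.< + c ℤ.- + d) ⇔ (a + d < c + b)
  diff-< = mk⇔
    (λ h → ℤₚ.drop‿+<+ (subst₂ ℤ._<_ left right (ℤₚ.+-monoˡ-< offset h)))
    (λ h → subst₂ ℤ._<_ (remove-offset _) (remove-offset _)
             (ℤₚ.+-monoˡ-< (ℤ.- offset) (subst₂ ℤ._<_ (sym left) (sym right) (ℤ.+<+ h))))

rowT-≡ : ∀ ν {n} (i : Fin n) → rowT ν i ≡ + toℕ i ℤ.- + part ν (suc (toℕ i))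
rowT-≡ ν i = trans (cong (λ z → (z ℤ.- + part ν (suc (toℕ i))) ℤ.- + 1) (ℤₚ.pos-+ 1 (toℕ i)))
                   (cancel (+ 1) (+ toℕ i) (+ part ν (suc (toℕ i))))
  where
  cancel : ∀ o r v → ((o +ℤ r) ℤ.- v) ℤ.- o ≡ r ℤ.- v
  cancel = solve-∀

rowT+k-≡ : ∀ ν {n} (i : Fin n) k →
           rowT ν i +ℤ + k ≡ + (toℕ i + k) ℤ.- + part ν (suc (toℕ i))
rowT+k-≡ ν i k = begin
  rowT ν i +ℤ + k                               ≡⟨ cong (_+ℤ + k) (rowT-≡ ν i) ⟩
  (+ toℕ i ℤ.- + νᵢ) +ℤ + k                     ≡⟨ swap (+ toℕ i) (+ νᵢ) (+ k) ⟩
  (+ toℕ i +ℤ + k) ℤ.- + νᵢ                     ≡⟨ cong (ℤ._- + νᵢ) (sym (ℤₚ.pos-+ (toℕ i) k)) ⟩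
  + (toℕ i + k) ℤ.- + νᵢ                        ∎
  where
  open ≡-Reasoning
  νᵢ : ℕ
  νᵢ = part ν (suc (toℕ i))
  swap : ∀ r v k → (r ℤ.- v) +ℤ k ≡ (r +ℤ k) ℤ.- v
  swap = solve-∀

part-step : ∀ {xs} → Linked _≥_ xs → ∀ i → part xs (suc (suc i)) ≤ part xs (suc i)
part-step []          i       = z≤n
part-step [-]         i       = z≤n
part-step (x≥y ∷ _)   zero    = x≥y
part-step (_ ∷ xs↘)   (suc i) = part-step xs↘ i

part-antitone : ∀ {xs} → Linked _≥_ xs → ∀ {i j} → i ≤ j → part xs (suc j) ≤ part xs (suc i)
part-antitone {xs} xs↘ = antitone′ ∘ ℕₚ.≤⇒≤′
  where
  antitone′ : ∀ {i j} → i ≤′ j → part xs (suc j) ≤ part xs (suc i)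
  antitone′ (_≤′_.≤′-reflexive refl) = ℕₚ.≤-refl
  antitone′ (_≤′_.≤′-step i≤′j)      = ℕₚ.≤-trans (part-step xs↘ _) (antitone′ i≤′j)

part-beyond-length : ∀ xs {i} → length xs < i → part xs i ≡ 0
part-beyond-length []       _                     = refl
part-beyond-length (x ∷ xs) {zero}          _     = refl
part-beyond-length (x ∷ xs) {suc zero}      (s≤s ())
part-beyond-length (x ∷ xs) {suc (suc i)}   (s≤s h) = part-beyond-length xs h

module Intervals (μ : List ℕ) (μ↘ : Linked _≥_ μ) (n : ℕ) where

  -- I_m = [start m, start (suc m)) for m < n; start 0 plays no role since μ_0 = ∞.
  start : ℕ → ℤ.ℤ
  start m = + m ℤ.- + part μ m

  start-mono : ∀ {p q} → p ≤ q → start (suc p) ℤ.≤ start (suc q)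
  start-mono {p} {q} p≤q = from (diff-≤ (suc p) (part μ (suc p)) (suc q) (part μ (suc q)))
                                (ℕₚ.+-mono-≤ (s≤s p≤q) (part-antitone μ↘ p≤q))

  InI⇒≤n : ∀ {m t} → InI μ n m t → m ≤ n
  InI⇒≤n (inj₁ (m<n , _))   = ℕₚ.<⇒≤ m<n
  InI⇒≤n (inj₂ (refl , _)) = ℕₚ.≤-refl

  InI-bounds : ∀ {m t} → m < n → InI μ n m t → LowerI μ m t × t ℤ.< start (suc m)
  InI-bounds _   (inj₁ (_ , low , up)) = low , up
  InI-bounds m<n (inj₂ (refl , _))     = ⊥-elim (ℕₚ.<-irrefl refl m<n)

  InI-below : ∀ {m t m'} → InI μ n m t → m' < n → t ℤ.< start (suc m') → m ≤ m'
  InI-below {zero} _ _ _ = z≤n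
  InI-below {suc m} {m' = m'} (inj₂ (refl , n≤t)) m'<n t<start =
    ⊥-elim (ℤₚ.<-irrefl refl (ℤₚ.<-≤-trans t<start (ℤₚ.≤-trans start≤n n≤t)))
    where
    start≤n : start (suc m') ℤ.≤ + n
    start≤n = ℤₚ.i≤j⇒i-k≤j (+ part μ (suc m')) (ℤ.+≤+ m'<n)
  InI-below {suc m} {m' = m'} (inj₁ (_ , low , _)) _ t<start with suc m ℕₚ.≤? m'
  ... | yes m<m' = m<m'
  ... | no m≮m'  = ⊥-elim (ℤₚ.<-irrefl refl
                     (ℤₚ.<-≤-trans t<start (ℤₚ.≤-trans (start-mono (ℕₚ.≮⇒≥ m≮m')) low)))

  InI-above : ∀ {m t m'} → InI μ n m t → m' < n → start (suc m') ℤ.≤ t → m' < m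
  InI-above (inj₂ (refl , _)) m'<n _ = m'<n
  InI-above {m} {m' = m'} (inj₁ (_ , _ , up)) _ start≤t with m' <? m
  ... | yes m'<m = m'<m
  ... | no m'≮m  = ⊥-elim (ℤₚ.<-irrefl refl
                     (ℤₚ.<-≤-trans up (ℤₚ.≤-trans (start-mono (ℕₚ.≮⇒≥ m'≮m)) start≤t)))

  InI-mono : ∀ {m t m' t'} → InI μ n m t → InI μ n m' t' → t ℤ.≤ t' → m ≤ m'
  InI-mono t∈ (inj₂ (refl , _))       _    = InI⇒≤n t∈
  InI-mono t∈ (inj₁ (m'<n , _ , up)) t≤t' = InI-below t∈ m'<n (ℤₚ.≤-<-trans t≤t' up)

  InI-unique : ∀ {m m' t} → InI μ n m t → InI μ n m' t → m ≡ m'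
  InI-unique t∈ t∈′ = ℕₚ.≤-antisym (InI-mono t∈ t∈′ ℤₚ.≤-refl) (InI-mono t∈′ t∈ ℤₚ.≤-refl)

tabulate-toℕ : ∀ n → tabulate {n = n} toℕ ≡ upTo n
tabulate-toℕ n = shifted n (λ x → x)
  where
  shifted : ∀ n (f : ℕ → ℕ) → tabulate {n = n} (f ∘ toℕ) ≡ applyUpTo f n
  shifted zero    f = refl
  shifted (suc n) f = cong (f 0 ∷_) (shifted n (f ∘ suc))

tabulate-injective : ∀ {n} (f g : Fin n → ℕ) → tabulate f ≡ tabulate g → ∀ i → f i ≡ g i
tabulate-injective f g eq Fin.zero    = proj₁ (∷-injective eq)
tabulate-injective f g eq (Fin.suc i) =
  tabulate-injective (f ∘ Fin.suc) (g ∘ Fin.suc) (proj₂ (∷-injective eq)) i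

Monotone : ∀ {n} → (Fin n → ℕ) → Set
Monotone f = ∀ i j → toℕ i ≤ toℕ j → f i ≤ f j

tabulate-sorted : ∀ {n} (f : Fin n → ℕ) → Monotone f → Linked _≤_ (tabulate f)
tabulate-sorted {zero}        f mono = []
tabulate-sorted {suc zero}    f mono = [-]
tabulate-sorted {suc (suc n)} f mono =
  mono Fin.zero (Fin.suc Fin.zero) z≤n
  ∷ tabulate-sorted (f ∘ Fin.suc) (λ i j i≤j → mono (Fin.suc i) (Fin.suc j) (s≤s i≤j))

monotone-↭-upTo⇒≗toℕ : ∀ {n} (f : Fin n → ℕ) → Monotone f → tabulate f ↭ upTo n →
                        ∀ i → f i ≡ toℕ i
monotone-↭-upTo⇒≗toℕ {n} f mono f↭ = tabulate-injective f toℕ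
  (Pointwise-≡⇒≡ (↗↭↗⇒≋ ℕₚ.≤-totalOrder (tabulate-sorted f mono)
                   (tabulate-sorted toℕ (λ _ _ i≤j → i≤j))
                   (↭⇒↭ₛ (subst (tabulate f ↭_) (sym (tabulate-toℕ n)) f↭))))

loop⇒cycle : ∀ {n} {a b : Fin n → Fin (suc n)} e → b e ≡ a e → HasCycle (Pgraph n a b)
loop⇒cycle {a = a} e b≡a =
  a e , [] , e ∷ [] , step e (inj₁ (refl , b≡a)) (single (a e)) , [] ∷ [] , [] ∷ []

-- Every vertex u < n has exactly one edge leading upwards from it, namely the edge u.
module UpwardEdges (n : ℕ) (a b : Fin n → Fin (suc n))
                   (a≗toℕ : ∀ e → toℕ (a e) ≡ toℕ e) (b-ascends : ∀ e → toℕ e < toℕ (b e)) where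

  G : Multigraph (Fin (suc n)) (Fin n)
  G = Pgraph n a b

  edge-direction : ∀ {e u w} → Joins G e u w →
    (toℕ u ≡ toℕ e × toℕ e < toℕ w) ⊎ (toℕ w ≡ toℕ e × toℕ e < toℕ u)
  edge-direction {e} (inj₁ (refl , refl)) = inj₁ (a≗toℕ e , b-ascends e)
  edge-direction {e} (inj₂ (refl , refl)) = inj₂ (a≗toℕ e , b-ascends e)

  Avoids : ℕ → List (Fin n) → Set
  Avoids x = All (λ f → ¬ toℕ f ≡ x)

  distinct⇒avoids : ∀ {e x es} → toℕ e ≡ x → All (λ f → ¬ e ≡ f) es → Avoids x es
  distinct⇒avoids e≡x []           = []
  distinct⇒avoids e≡x (e≢f ∷ e∉es) =
    (λ f≡x → e≢f (sym (toℕ-injective (trans f≡x (sym e≡x))))) ∷ distinct⇒avoids e≡x e∉es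

  walk-descends : ∀ {u v es} → Walk G u v es → Unique es → Avoids (toℕ u) es → toℕ v ≤ toℕ u
  walk-descends nil _ _ = ℕₚ.≤-refl
  walk-descends (cons e j walk) (e∉es ∷ distinct) (e≢u ∷ _) with edge-direction j
  ... | inj₁ (u≡e , _)   = ⊥-elim (e≢u (sym u≡e))
  ... | inj₂ (w≡e , e<u) = ℕₚ.≤-trans (walk-descends walk distinct (distinct⇒avoids (sym w≡e) e∉es))
                                      (ℕₚ.<⇒≤ (subst (_< _) (sym w≡e) e<u))

  walk-ascends-or-uses : ∀ {u v es} → Walk G u v es → Unique es →
                         toℕ u ≤ toℕ v ⊎ Any (λ f → toℕ f ≡ toℕ v) es
  walk-ascends-or-uses nil _ = inj₁ ℕₚ.≤-refl
  walk-ascends-or-uses (cons e j walk) (e∉es ∷ distinct)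
    with walk-ascends-or-uses walk distinct | edge-direction j
  ... | inj₂ uses         | _                = inj₂ (there uses)
  ... | inj₁ w≤v          | inj₁ (u≡e , e<w) =
        inj₁ (ℕₚ.<⇒≤ (ℕₚ.<-≤-trans (subst (_< _) (sym u≡e) e<w) w≤v))
  ... | inj₁ w≤v          | inj₂ (w≡e , _) with ℕₚ.m≤n⇒m<n∨m≡n w≤v
  ...   | inj₂ w≡v = inj₂ (here (trans (sym w≡e) w≡v))
  ...   | inj₁ w<v = ⊥-elim (ℕₚ.<⇒≱ w<v
                       (walk-descends walk distinct (distinct⇒avoids (sym w≡e) e∉es)))

  closed-walk-impossible : ∀ {v w e es} → Joins G e v w → Walk G w v es → ¬ Unique (e ∷ es)
  closed-walk-impossible j walk (e∉es ∷ distinct) with edge-direction j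
  ... | inj₁ (v≡e , e<w) with walk-ascends-or-uses walk distinct
  ...   | inj₁ w≤v  = ℕₚ.<⇒≱ (subst (_< _) (sym v≡e) e<w) w≤v
  ...   | inj₂ uses = All¬⇒¬Any (distinct⇒avoids (sym v≡e) e∉es) uses
  closed-walk-impossible j walk (e∉es ∷ distinct) | inj₂ (w≡e , e<v) =
    ℕₚ.<⇒≱ e<v (subst (_ ≤_) w≡e (walk-descends walk distinct (distinct⇒avoids (sym w≡e) e∉es)))

  trail⇒walk : ∀ {u w} xs {es} → Trail G (u ∷ xs ++ w ∷ []) es → Walk G u w es
  trail⇒walk []       (step e j (single _)) = cons e j nil
  trail⇒walk (x ∷ xs) (step e j trail)      = cons e j (trail⇒walk xs trail)

  acyclic : ¬ HasCycle G
  acyclic (_ , []     , _ , step e j (single _) , _ , distinct) =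
    closed-walk-impossible j nil distinct
  acyclic (_ , x ∷ xs , _ , step e j trail      , _ , distinct) =
    closed-walk-impossible j (trail⇒walk xs trail) distinct

  _++ʷ_ : ∀ {u v w es fs} → Walk G u v es → Walk G v w fs → Walk G u w (es ++ fs)
  nil          ++ʷ q = q
  cons e j p   ++ʷ q = cons e j (p ++ʷ q)

  reverseʷ : ∀ {u v es} → Walk G u v es → ∃ (Walk G v u)
  reverseʷ nil = [] , nil
  reverseʷ (cons e j p) with reverseʷ p
  ... | fs , q = fs ++ e ∷ [] , q ++ʷ cons e (Sum.swap j) nil

  root : Fin (suc n)
  root = fromℕ n

  ≮n⇒root : ∀ {u} → ¬ toℕ u < n → u ≡ root
  ≮n⇒root {u} u≮n =
    toℕ-injective (trans (ℕₚ.≤-antisym (toℕ≤pred[n] u) (ℕₚ.≮⇒≥ u≮n)) (sym (toℕ-fromℕ n)))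

  upward-edge : ∀ {u} → toℕ u < n → ∃ λ e → Joins G e u (b e) × toℕ u < toℕ (b e)
  upward-edge {u} u<n =
    e , inj₁ (a≡u , refl) , subst (_< toℕ (b e)) (toℕ-fromℕ< u<n) (b-ascends e)
    where
    e : Fin n
    e = fromℕ< u<n
    a≡u : a e ≡ u
    a≡u = toℕ-injective (trans (a≗toℕ e) (toℕ-fromℕ< u<n))

  walk-to-root : ∀ fuel u → n ≤ toℕ u + fuel → ∃ (Walk G u root)
  walk-to-root fuel u n≤u+fuel with toℕ u <? n
  ... | no u≮n = [] , subst (λ z → Walk G z root []) (sym (≮n⇒root u≮n)) nil
  walk-to-root zero u n≤u | yes u<n =
    ⊥-elim (ℕₚ.<⇒≱ u<n (subst (n ≤_) (ℕₚ.+-identityʳ _) n≤u))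
  walk-to-root (suc fuel) u n≤u+fuel | yes u<n with upward-edge u<n
  ... | e , j , u<b with walk-to-root fuel (b e) (ℕₚ.≤-trans n≤u+fuel
                           (ℕₚ.≤-trans (ℕₚ.≤-reflexive (ℕₚ.+-suc (toℕ u) fuel))
                                       (ℕₚ.+-monoˡ-≤ fuel u<b)))
  ... | es , walk = e ∷ es , cons e j walk

  connected : Connected G
  connected u v with walk-to-root n u (ℕₚ.m≤n+m n (toℕ u)) | walk-to-root n v (ℕₚ.m≤n+m n (toℕ v))
  ... | es , u→root | _ , v→root with reverseʷ v→root
  ... | fs , root→v = es ++ fs , u→root ++ʷ root→v

  isTree : IsTree G
  isTree = connected , acyclic

module Rows (k : ℕ) (ν μ : List ℕ) (ν↘ : Linked _≥_ ν) (μ↘ : Linked _≥_ μ)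
            (n : ℕ) (ℓν≤n : length ν ≤ n) (ℓμ<n : length μ < n)
            (a b : Fin n → Fin (suc n))
            (a∈ : ∀ i → InI μ n (toℕ (a i)) (rowT ν i))
            (b∈ : ∀ i → InI μ n (toℕ (b i)) (rowT ν i +ℤ + k)) where

  open Intervals μ μ↘ n

  ν-vanishes : ∀ {i} → n < i → part ν i ≡ 0
  ν-vanishes n<i = part-beyond-length ν (ℕₚ.≤-<-trans ℓν≤n n<i)

  μ-vanishes : ∀ {i} → n < i → part μ i ≡ 0
  μ-vanishes n<i = part-beyond-length μ (ℕₚ.<-trans ℓμ<n n<i)

  -- Rows beyond n vanish, so only the first n rows need to interlace.
  Interlacing : Set
  Interlacing = (∀ r → r < n → part μ (suc r) ≤ part ν (suc r))
              × (∀ r → suc r < n → part ν (suc (suc r)) ≤ part μ (suc r))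

  strip⇒interlacing : HorizontalStrip ν μ → Interlacing
  strip⇒interlacing (μ≤ν , one-per-column) = (λ r _ → μ≤ν (suc r) (s≤s z≤n)) , ν≤μ
    where
    ν≤μ : ∀ r → suc r < n → part ν (suc (suc r)) ≤ part μ (suc r)
    ν≤μ r _ with part ν (suc (suc r)) ℕₚ.≤? part μ (suc r)
    ... | yes ν≤μ = ν≤μ
    ... | no ν≰μ  = ⊥-elim (ℕₚ.<-irrefl (one-per-column _ _ j upper lower) ℕₚ.≤-refl)
      where
      j = part ν (suc (suc r))
      μ<j : part μ (suc r) < j
      μ<j = ℕₚ.≰⇒> ν≰μ
      upper : InSkew ν μ (suc r) j
      upper = s≤s z≤n , μ<j , part-step ν↘ r
      lower : InSkew ν μ (suc (suc r)) j
      lower = s≤s z≤n , ℕₚ.≤-<-trans (part-step μ↘ r) μ<j , ℕₚ.≤-refl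

  interlacing⇒strip : Interlacing → HorizontalStrip ν μ
  interlacing⇒strip (μ≤ν , ν≤μ) = μ≤ν′ , λ i i' j c c' →
    ℕₚ.≤-antisym (ℕₚ.≮⇒≥ (no-two-cells c' c)) (ℕₚ.≮⇒≥ (no-two-cells c c'))
    where
    μ≤ν′ : ∀ i → 1 ≤ i → part μ i ≤ part ν i
    μ≤ν′ (suc r) _ with r <? n
    ... | yes r<n = μ≤ν r r<n
    ... | no r≮n  = subst (_≤ part ν (suc r)) (sym (μ-vanishes (s≤s (ℕₚ.≮⇒≥ r≮n)))) z≤n
    no-two-cells : ∀ {i i' j} → InSkew ν μ i j → InSkew ν μ i' j → ¬ i < i'
    no-two-cells {suc r} {suc r'} {j} (_ , μ<j , _) (_ , _ , j≤ν) (s≤s r<r') with suc r <? n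
    ... | yes r+1<n = ℕₚ.<-irrefl refl (ℕₚ.<-≤-trans μ<j
                        (ℕₚ.≤-trans j≤ν (ℕₚ.≤-trans (part-antitone ν↘ r<r') (ν≤μ r r+1<n))))
    ... | no r+1≮n  = ℕₚ.<-irrefl refl (ℕₚ.<-≤-trans (ℕₚ.≤-<-trans z≤n μ<j)
                        (subst (j ≤_) (ν-vanishes (ℕₚ.≤-<-trans (ℕₚ.≮⇒≥ r+1≮n) (s≤s r<r'))) j≤ν))

  strip⇔interlacing : HorizontalStrip ν μ ⇔ Interlacing
  strip⇔interlacing = mk⇔ strip⇒interlacing interlacing⇒strip

  diagonal : ℕ → ℤ.ℤ
  diagonal r = + r ℤ.- + part ν (suc r)

  diagonal-below-end : ∀ r → (diagonal r ℤ.< start (suc r)) ⇔ (part μ (suc r) ≤ part ν (suc r))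
  diagonal-below-end r = mk⇔
    (λ h → ℕₚ.+-cancelˡ-≤ r _ _ (s≤s⁻¹ (to diff h)))
    (λ h → from diff (s≤s (ℕₚ.+-monoʳ-≤ r h)))
    where
    diff : (diagonal r ℤ.< start (suc r)) ⇔ (r + part μ (suc r) < suc r + part ν (suc r))
    diff = diff-< r (part ν (suc r)) (suc r) (part μ (suc r))

  diagonal-above-start : ∀ r →
    (start (suc r) ℤ.≤ diagonal (suc r)) ⇔ (part ν (suc (suc r)) ≤ part μ (suc r))
  diagonal-above-start r = mk⇔
    (λ h → ℕₚ.+-cancelˡ-≤ (suc r) _ _ (to diff h))
    (λ h → from diff (ℕₚ.+-monoʳ-≤ (suc r) h))
    where
    diff : (start (suc r) ℤ.≤ diagonal (suc r))
         ⇔ (suc r + part ν (suc (suc r)) ≤ suc r + part μ (suc r))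
    diff = diff-≤ (suc r) (part μ (suc r)) (suc r) (part ν (suc (suc r)))

  DiagonalInI : Set
  DiagonalInI = ∀ r → r < n → InI μ n r (diagonal r)

  interlacing⇔diagonalInI : Interlacing ⇔ DiagonalInI
  interlacing⇔diagonalInI = mk⇔ in-I interlacing
    where
    in-I : Interlacing → DiagonalInI
    in-I (μ≤ν , _)   zero    r<n = inj₁ (r<n , tt , from (diagonal-below-end 0) (μ≤ν 0 r<n))
    in-I (μ≤ν , ν≤μ) (suc r) r<n =
      inj₁ (r<n , from (diagonal-above-start r) (ν≤μ r r<n)
                , from (diagonal-below-end (suc r)) (μ≤ν (suc r) r<n))
    interlacing : DiagonalInI → Interlacing
    interlacing in-I =
      (λ r r<n → to (diagonal-below-end r) (proj₂ (InI-bounds r<n (in-I r r<n)))) ,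
      (λ r r<n → to (diagonal-above-start r) (proj₁ (InI-bounds r<n (in-I (suc r) r<n))))

  -- Row i of Pet_k starts in column i, i.e. a_i = i - 1 (rows are indexed from 0 here).
  DiagonalStart : Set
  DiagonalStart = ∀ i → toℕ (a i) ≡ toℕ i

  diagonal-row : DiagonalStart → ∀ i → InI μ n (toℕ i) (diagonal (toℕ i))
  diagonal-row a≗toℕ i = subst₂ (InI μ n) (a≗toℕ i) (rowT-≡ ν i) (a∈ i)

  diagonalStart⇔diagonalInI : DiagonalStart ⇔ DiagonalInI
  diagonalStart⇔diagonalInI = mk⇔
    (λ a≗toℕ r r<n → subst (λ r → InI μ n r (diagonal r)) (toℕ-fromℕ< r<n)
                       (diagonal-row a≗toℕ (fromℕ< r<n)))
    (λ in-I i → InI-unique (a∈ i)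
                  (subst (InI μ n (toℕ i)) (sym (rowT-≡ ν i)) (in-I (toℕ i) (toℕ<n i))))

  strip⇔diagonalStart : HorizontalStrip ν μ ⇔ DiagonalStart
  strip⇔diagonalStart =
    ⇔-sym diagonalStart⇔diagonalInI ⇔-∘ (interlacing⇔diagonalInI ⇔-∘ strip⇔interlacing)

  a-monotone : Monotone (toℕ ∘ a)
  a-monotone i j i≤j = InI-mono (a∈ i) (a∈ j) (subst₂ ℤ._≤_ (sym (rowT-≡ ν i)) (sym (rowT-≡ ν j))
    (from (diff-≤ (toℕ i) (part ν (suc (toℕ i))) (toℕ j) (part ν (suc (toℕ j))))
          (ℕₚ.+-mono-≤ i≤j (part-antitone ν↘ i≤j))))

  base⇔diagonalStart : IsBaseGraph n a ⇔ DiagonalStart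
  base⇔diagonalStart = mk⇔
    (λ base → monotone-↭-upTo⇒≗toℕ (toℕ ∘ a) a-monotone
                (subst (_↭ upTo n) (map-tabulate a toℕ) base))
    (λ a≗toℕ → ↭-reflexive (trans (map-tabulate a toℕ)
                             (trans (tabulate-cong a≗toℕ) (tabulate-toℕ n))))

  RowBound : Set
  RowBound = ∀ i → 1 ≤ i → part ν i < part μ i + k

  start-≤-row+k : ∀ (e : Fin n) → part ν (suc (toℕ e)) < part μ (suc (toℕ e)) + k →
                  start (suc (toℕ e)) ℤ.≤ rowT ν e +ℤ + k
  start-≤-row+k e bounded = subst (start (suc r) ℤ.≤_) (sym (rowT+k-≡ ν e k))
    (from (diff-≤ (suc r) (part μ (suc r)) (r + k) (part ν (suc r))) (begin
      suc r + part ν (suc r)         ≡⟨ ℕₚ.+-suc r _ ⟨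
      r + suc (part ν (suc r))       ≤⟨ ℕₚ.+-monoʳ-≤ r bounded ⟩
      r + (part μ (suc r) + k)       ≡⟨ x∙yz≈xz∙y r _ k ⟩
      r + k + part μ (suc r)         ∎))
    where
    open ℕₚ.≤-Reasoning hiding (start)
    r : ℕ
    r = toℕ e

  row+k-<-start : ∀ (e : Fin n) → part μ (suc (toℕ e)) + k ≤ part ν (suc (toℕ e)) →
                  rowT ν e +ℤ + k ℤ.< start (suc (toℕ e))
  row+k-<-start e unbounded = subst (ℤ._< start (suc r)) (sym (rowT+k-≡ ν e k))
    (from (diff-< (r + k) (part ν (suc r)) (suc r) (part μ (suc r))) (s≤s (begin
      r + k + part μ (suc r)         ≡⟨ x∙yz≈xz∙y r _ k ⟨
      r + (part μ (suc r) + k)       ≤⟨ ℕₚ.+-monoʳ-≤ r unbounded ⟩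
      r + part ν (suc r)             ∎)))
    where
    open ℕₚ.≤-Reasoning hiding (start)
    r : ℕ
    r = toℕ e

  bounded⇒b-ascends : RowBound → ∀ e → toℕ e < toℕ (b e)
  bounded⇒b-ascends bounded e =
    InI-above (b∈ e) (toℕ<n e) (start-≤-row+k e (bounded (suc (toℕ e)) (s≤s z≤n)))

  bounded-from-rows : 1 ≤ k → (∀ e → part ν (suc (toℕ e)) < part μ (suc (toℕ e)) + k) → RowBound
  bounded-from-rows k≥1 row-bound (suc r) _ with r <? n
  ... | yes r<n = subst (λ r → part ν (suc r) < part μ (suc r) + k) (toℕ-fromℕ< r<n)
                    (row-bound (fromℕ< r<n))
  ... | no r≮n  = subst (_< part μ (suc r) + k) (sym (ν-vanishes (s≤s (ℕₚ.≮⇒≥ r≮n))))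
                    (ℕₚ.≤-trans k≥1 (ℕₚ.m≤n+m k _))

  acyclic⇒bounded : 1 ≤ k → DiagonalStart → ¬ HasCycle (Pgraph n a b) → RowBound
  acyclic⇒bounded k≥1 a≗toℕ acyclic = bounded-from-rows k≥1 row-bound
    where
    row-bound : ∀ e → part ν (suc (toℕ e)) < part μ (suc (toℕ e)) + k
    row-bound e with part ν (suc (toℕ e)) <? part μ (suc (toℕ e)) + k
    ... | yes bounded  = bounded
    ... | no unbounded = ⊥-elim (acyclic (loop⇒cycle e (toℕ-injective (ℕₚ.≤-antisym b≤a a≤b))))
      where
      b≤a : toℕ (b e) ≤ toℕ (a e)
      b≤a = subst (toℕ (b e) ≤_) (sym (a≗toℕ e))
              (InI-below (b∈ e) (toℕ<n e) (row+k-<-start e (ℕₚ.≮⇒≥ unbounded)))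
      a≤b : toℕ (a e) ≤ toℕ (b e)
      a≤b = InI-mono (a∈ e) (b∈ e) (ℤₚ.i≤i+j (rowT ν e) (+ k))

proposition6p8 :
    (k : ℕ) → 1 ≤ k →
    (ν μ : List ℕ) → IsPartition ν → IsPartition μ →
    (n : ℕ) → length ν ≤ n → length μ < n →
    (a b : Fin n → Fin (suc n)) →
    (∀ i → InI μ n (toℕ (a i)) (rowT ν i)) →
    (∀ i → InI μ n (toℕ (b i)) (rowT ν i +ℤ + k)) →
    (HorizontalStrip ν μ ⇔ IsBaseGraph n a)
    × ((IsBaseGraph n a × IsTree (Pgraph n a b))
       ⇔ (HorizontalStrip ν μ × (∀ i → 1 ≤ i → part ν i < part μ i + k)))
proposition6p8 k k≥1 ν μ (_ , ν↘) (_ , μ↘) n ℓν≤n ℓμ<n a b a∈ b∈ =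
  strip⇔base , mk⇔ tree⇒bounded-strip bounded-strip⇒tree
  where
  open Rows k ν μ ν↘ μ↘ n ℓν≤n ℓμ<n a b a∈ b∈

  strip⇔base : HorizontalStrip ν μ ⇔ IsBaseGraph n a
  strip⇔base = ⇔-sym base⇔diagonalStart ⇔-∘ strip⇔diagonalStart

  tree⇒bounded-strip : IsBaseGraph n a × IsTree (Pgraph n a b) → HorizontalStrip ν μ × RowBound
  tree⇒bounded-strip (base , _ , acyclic) =
    from strip⇔base base , acyclic⇒bounded k≥1 (to base⇔diagonalStart base) acyclic

  bounded-strip⇒tree : HorizontalStrip ν μ × RowBound → IsBaseGraph n a × IsTree (Pgraph n a b)
  bounded-strip⇒tree (strip , bounded) =
    to strip⇔base strip ,
    UpwardEdges.isTree n a b (to strip⇔diagonalStart strip) (bounded⇒b-ascends bounded)
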